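{- Let $P(q,z,t)=\sum_{\pi} z^{|\pi|}\,q^{\#123(\pi)}\,t^{\#12(\pi)}$, where the sum is over all 132-avoiding permutations $\pi$ of $\{1,\dots,n\}$ for all $n\ge 0$ (including the empty permutation). Then, as formal power series, $$P(q,z,t)=1+z\,P(q,zt,qt)\,P(q,z,t).$$
   Context: For a permutation $\pi=\pi_1\cdots\pi_n$ of $\{1,\dots,n\}$, $|\pi|=n$; $\#12(\pi)$ is the number of pairs $i_1<i_2$ with $\pi_{i_1}<\pi_{i_2}$; $\#123(\pi)$ is the number of triples $i_1<i_2<i_3$ with $\pi_{i_1}<\pi_{i_2}<\pi_{i_3}$; $\#132(\pi)$ is the number of triples $i_1<i_2<i_3$ with $\pi_{i_1}<\pi_{i_3}<\pi_{i_2}$. A permutation is 132-avoiding if $\#132(\pi)=0$. $P$ is a formal power series in $z$ whose coefficients are polynomials in $q,t$. -}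

module Defs where

open import Data.Nat using (ℕ; zero; suc; _∸_)
open import Data.Bool using (Bool; true; false; _∧_; not)
open import Data.Fin as F using (Fin)
open import Data.Vec using (Vec; []; _∷_; lookup)
open import Data.List using (List; []; _∷_; [_]; map; concatMap; filterᵇ; length; foldr; allFin; upTo)
open import Data.Product using (_×_; _,_)
open import Relation.Nullary.Decidable using (⌊_⌋)
open import Algebra.Bundles using (CommutativeSemiring)

words : (n k : ℕ) → List (Vec (Fin k) n)
words zero    k = [ [] ]
words (suc n) k = concatMap (λ x → map (x ∷_) (words n k)) (allFin k)

idx2 : (n : ℕ) → List (Fin n × Fin n)
idx2 n = concatMap (λ i → concatMap (λ j →
           filterᵇ (λ _ → ⌊ i F.<? j ⌋) [ (i , j) ]) (allFin n)) (allFin n)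

idx3 : (n : ℕ) → List (Fin n × Fin n × Fin n)
idx3 n = concatMap (λ i → concatMap (λ j → concatMap (λ k →
           filterᵇ (λ _ → ⌊ i F.<? j ⌋ ∧ ⌊ j F.<? k ⌋) [ (i , j , k) ])
           (allFin n)) (allFin n)) (allFin n)

-- A permutation of size n is represented as the word π = π_1 ⋯ π_n (values in Fin n,
-- i.e. {0,…,n-1} instead of {1,…,n}; only relative order matters) which is injective.
allᵇ : {A : Set} → (A → Bool) → List A → Bool
allᵇ p = foldr (λ x b → p x ∧ b) true

isPerm : {n : ℕ} → Vec (Fin n) n → Bool
isPerm {n} π = allᵇ (λ { (i , j) → not ⌊ lookup π i F.≟ lookup π j ⌋ }) (idx2 n)

count12 : {n : ℕ} → Vec (Fin n) n → ℕ
count12 {n} π = length (filterᵇ (λ { (i , j) → ⌊ lookup π i F.<? lookup π j ⌋ }) (idx2 n))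

count123 : {n : ℕ} → Vec (Fin n) n → ℕ
count123 {n} π = length (filterᵇ (λ { (i , j , k) →
  ⌊ lookup π i F.<? lookup π j ⌋ ∧ ⌊ lookup π j F.<? lookup π k ⌋ }) (idx3 n))

count132 : {n : ℕ} → Vec (Fin n) n → ℕ
count132 {n} π = length (filterᵇ (λ { (i , j , k) →
  ⌊ lookup π i F.<? lookup π k ⌋ ∧ ⌊ lookup π k F.<? lookup π j ⌋ }) (idx3 n))

isZero : ℕ → Bool
isZero zero    = true
isZero (suc _) = false

avoiders132 : (n : ℕ) → List (Vec (Fin n) n)
avoiders132 n = filterᵇ (λ π → isPerm π ∧ isZero (count132 π)) (words n n)

-- Formal power series in z with coefficients in a commutative semiring R.
-- (Polynomials in q,t are handled by letting q,t be arbitrary elements of an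
--  arbitrary commutative semiring, e.g. the polynomial semiring ℕ[q,t] itself.)
module Series {c ℓ} (R : CommutativeSemiring c ℓ) where
  open CommutativeSemiring R

  pow : Carrier → ℕ → Carrier
  pow x zero    = 1#
  pow x (suc n) = x * pow x n

  sumR : List Carrier → Carrier
  sumR = foldr _+_ 0#

  FPS : Set c
  FPS = ℕ → Carrier   -- n ↦ coefficient of z^n

  oneS : FPS
  oneS zero    = 1#
  oneS (suc _) = 0#

  zS : FPS
  zS (suc zero) = 1#
  zS _          = 0#

  _⊕_ : FPS → FPS → FPS
  (f ⊕ g) n = f n + g n

  _⊙_ : FPS → FPS → FPS
  (f ⊙ g) n = sumR (map (λ k → f k * g (n ∸ k)) (upTo (suc n)))

  -- substitution z ↦ z·t :  F(zt) has z^n-coefficient t^n · F_n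
  substZ : Carrier → FPS → FPS
  substZ t f n = pow t n * f n

  P : Carrier → Carrier → FPS
  P q t n = sumR (map (λ π → pow q (count123 π) * pow t (count12 π)) (avoiders132 n))

-- A 132-avoiding permutation π of size n + 1 splits at its maximum as π = α′ n β, where every entry
-- of α′ exceeds every entry of β (otherwise a , n , b would be an occurrence of 132).  So β is a
-- 132-avoiding permutation of {0, …, m - 1} and α′ is a 132-avoider α of size k = n - m shifted up
-- by m; conversely every such gluing of two avoiders avoids 132.  The only occurrences of 12 meeting
-- two of the parts α′, n, β are the k pairs (a , n), and the only such occurrences of 123 are the
-- triples (a , a′ , n) with a a′ an occurrence of 12 in α′.  Hence
--   #12 π = #12 α + k + #12 β   and   #123 π = #123 α + #12 α + #123 β,
-- so q^#123 t^#12 of π is t^k · q^#123 (qt)^#12 of α · q^#123 t^#12 of β.  Summing over all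
-- gluings, the coefficient of z^(n+1) in P(q,z,t) is ∑ₖ t^k Pₖ(q,qt) Pₙ₋ₖ(q,t), which is the
-- coefficient of z^(n+1) in z P(q,zt,qt) P(q,z,t).

module Submission where

open import Defs
open import Data.Nat using (ℕ)
open import Algebra.Bundles using (CommutativeSemiring)
open import Data.Nat using (zero; suc)

module Permutations where

  open import Data.Bool using (Bool; true; false; _∧_; not; T; if_then_else_)
  open import Data.Bool.Properties using (∧-zeroʳ; ∧-identityʳ; not-involutive; T-∧; T-≡)
  open import Data.Empty using (⊥-elim)
  open import Data.Fin as Fin using (Fin; toℕ)
  import Data.Fin.Properties as Fin
  open import Data.List
    using (List; []; _∷_; [_]; _++_; map; concatMap; filterᵇ; length; tabulate; allFin; applyUpTo; upTo; take)
  import Data.List.Properties as List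
  open import Data.List.Membership.Propositional using (_∈_; find; lose)
  import Data.List.Membership.Propositional.Properties as Mem
  open import Data.List.Relation.Binary.Subset.Propositional using (_⊆_)
  open import Data.List.Relation.Unary.All as All using (All; []; _∷_)
  import Data.List.Relation.Unary.All.Properties as All
  open import Data.List.Relation.Unary.AllPairs as AllPairs using (AllPairs; []; _∷_)
  open import Data.List.Relation.Unary.Any using (here; there)
  open import Data.List.Relation.Unary.Unique.Propositional using (Unique)
  import Data.List.Relation.Unary.Unique.Propositional.Properties as Unique
  open import Data.Nat using (_+_; _∸_; _<_; _≤_; _<ᵇ_; _≡ᵇ_; z≤n; s≤s)
  import Data.Nat.Properties as ℕ
  open import Data.Nat.Solver using (module +-*-Solver)
  open +-*-Solver using (solve; _:+_; con; _:=_)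
  open import Data.Product using (_×_; _,_; proj₁; proj₂; ∃)
  open import Data.Vec as Vec using (Vec; []; _∷_; lookup)
  import Data.Vec.Properties as Vec
  open import Function using (_∘_)
  open import Function.Bundles using (_⇔_; mk⇔; Equivalence)
  open import Relation.Binary.PropositionalEquality
    using (_≡_; _≢_; refl; sym; trans; cong; cong₂; subst; ≢-sym; module ≡-Reasoning)
  open import Relation.Nullary using (¬_; yes; no)
  open import Relation.Nullary.Decidable using (⌊_⌋; T?; isYes≗does; does-⇔)

  open import Algebra.Properties.Monoid.Sum ℕ.+-0-monoid using (sum; sum-cong-≗; sum-replicate-zero)
  open import Data.List.Membership.DecPropositional ℕ._≟_ using (_∈?_)

  private
    variable
      A : Set

  indicator : Bool → ℕ
  indicator true  = 1
  indicator false = 0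

  countᵇ : (A → Bool) → List A → ℕ
  countᵇ p xs = length (filterᵇ p xs)

  countᵇ-∷ : ∀ (p : A → Bool) x xs → countᵇ p (x ∷ xs) ≡ indicator (p x) + countᵇ p xs
  countᵇ-∷ p x xs with p x
  ... | true  = refl
  ... | false = refl

  countᵇ-accept : ∀ (p : A → Bool) x xs → T (p x) → countᵇ p (x ∷ xs) ≡ suc (countᵇ p xs)
  countᵇ-accept p x xs px = cong length (List.filter-accept (T? ∘ p) px)

  countᵇ-++ : ∀ (p : A → Bool) xs ys → countᵇ p (xs ++ ys) ≡ countᵇ p xs + countᵇ p ys
  countᵇ-++ p xs ys =
    trans (cong length (List.filter-++ (T? ∘ p) xs ys)) (List.length-++ (filterᵇ p xs))

  countᵇ-map : ∀ {B : Set} (p : B → Bool) (q : A → Bool) (g : A → B) xs →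
    (∀ x → p (g x) ≡ q x) → countᵇ p (map g xs) ≡ countᵇ q xs
  countᵇ-map p q g []       _   = refl
  countᵇ-map p q g (x ∷ xs) p≡q = begin
    countᵇ p (g x ∷ map g xs)                  ≡⟨ countᵇ-∷ p (g x) (map g xs) ⟩
    indicator (p (g x)) + countᵇ p (map g xs)  ≡⟨ cong₂ _+_ (cong indicator (p≡q x)) (countᵇ-map p q g xs p≡q) ⟩
    indicator (q x) + countᵇ q xs              ≡⟨ countᵇ-∷ q x xs ⟨
    countᵇ q (x ∷ xs)                          ∎
    where open ≡-Reasoning

  countᵇ-none : ∀ (p : A → Bool) {xs} → All (λ x → ¬ T (p x)) xs → countᵇ p xs ≡ 0
  countᵇ-none p none = cong length (List.filter-none (T? ∘ p) none)

  countᵇ≡0⇒none : ∀ (p : A → Bool) xs → countᵇ p xs ≡ 0 → All (λ x → ¬ T (p x)) xs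
  countᵇ≡0⇒none p xs c = All.¬Any⇒All¬ xs (λ some → ℕ.<⇒≢ (List.filter-some (T? ∘ p) some) (sym c))

  count₂ : (A → A → Bool) → List A → ℕ
  count₂ P []       = 0
  count₂ P (x ∷ xs) = countᵇ (P x) xs + count₂ P xs

  count₃ : (A → A → A → Bool) → List A → ℕ
  count₃ P []       = 0
  count₃ P (x ∷ xs) = count₂ (P x) xs + count₃ P xs

  countCross : (A → A → Bool) → List A → List A → ℕ
  countCross P []       ys = 0
  countCross P (x ∷ xs) ys = countᵇ (P x) ys + countCross P xs ys

  count₂-map : ∀ {B : Set} (P : B → B → Bool) (Q : A → A → Bool) (g : A → B) xs →
    (∀ x y → P (g x) (g y) ≡ Q x y) → count₂ P (map g xs) ≡ count₂ Q xs
  count₂-map P Q g []       _   = refl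
  count₂-map P Q g (x ∷ xs) P≡Q =
    cong₂ _+_ (countᵇ-map (P (g x)) (Q x) g xs (P≡Q x)) (count₂-map P Q g xs P≡Q)

  count₃-map : ∀ {B : Set} (P : B → B → B → Bool) (Q : A → A → A → Bool) (g : A → B) xs →
    (∀ x y z → P (g x) (g y) (g z) ≡ Q x y z) → count₃ P (map g xs) ≡ count₃ Q xs
  count₃-map P Q g []       _   = refl
  count₃-map P Q g (x ∷ xs) P≡Q =
    cong₂ _+_ (count₂-map (P (g x)) (Q x) g xs (P≡Q x)) (count₃-map P Q g xs P≡Q)

  count₂-++ : ∀ (P : A → A → Bool) xs ys →
    count₂ P (xs ++ ys) ≡ count₂ P xs + countCross P xs ys + count₂ P ys
  count₂-++ P []       ys = refl
  count₂-++ P (x ∷ xs) ys = begin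
    countᵇ (P x) (xs ++ ys) + count₂ P (xs ++ ys)
      ≡⟨ cong₂ _+_ (countᵇ-++ (P x) xs ys) (count₂-++ P xs ys) ⟩
    (countᵇ (P x) xs + countᵇ (P x) ys) + (count₂ P xs + countCross P xs ys + count₂ P ys)
      ≡⟨ solve 5 (λ a b c d e → (a :+ b) :+ ((c :+ d) :+ e) := ((a :+ c) :+ (b :+ d)) :+ e) refl
           (countᵇ (P x) xs) (countᵇ (P x) ys) (count₂ P xs) (countCross P xs ys) (count₂ P ys) ⟩
    (countᵇ (P x) xs + count₂ P xs) + (countᵇ (P x) ys + countCross P xs ys) + count₂ P ys ∎
    where open ≡-Reasoning

  count₂-none : ∀ (P : A → A → Bool) {xs} → AllPairs (λ x y → ¬ T (P x y)) xs → count₂ P xs ≡ 0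
  count₂-none P []         = refl
  count₂-none P (h ∷ none) = cong₂ _+_ (countᵇ-none (P _) h) (count₂-none P none)

  count₂≡0⇒none : ∀ (P : A → A → Bool) xs → count₂ P xs ≡ 0 → AllPairs (λ x y → ¬ T (P x y)) xs
  count₂≡0⇒none P []       _ = []
  count₂≡0⇒none P (x ∷ xs) c =
    countᵇ≡0⇒none (P x) xs (ℕ.m+n≡0⇒m≡0 _ c) ∷ count₂≡0⇒none P xs (ℕ.m+n≡0⇒n≡0 _ c)

  count₂-vanish : ∀ (P : A → A → Bool) xs → (∀ {x y} → x ∈ xs → y ∈ xs → ¬ T (P x y)) → count₂ P xs ≡ 0
  count₂-vanish P []       _  = refl
  count₂-vanish P (x ∷ xs) ¬P = cong₂ _+_
    (countᵇ-none (P x) (All.tabulate (λ y∈ → ¬P (here refl) (there y∈))))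
    (count₂-vanish P xs (λ x∈ y∈ → ¬P (there x∈) (there y∈)))

  countCross-vanish : ∀ (P : A → A → Bool) xs ys → (∀ {x y} → x ∈ xs → y ∈ ys → ¬ T (P x y)) →
    countCross P xs ys ≡ 0
  countCross-vanish P []       ys _  = refl
  countCross-vanish P (x ∷ xs) ys ¬P = cong₂ _+_
    (countᵇ-none (P x) (All.tabulate (λ y∈ → ¬P (here refl) y∈)))
    (countCross-vanish P xs ys (λ x∈ y∈ → ¬P (there x∈) y∈))

  countCross-countᵇ : ∀ (P : A → A → Bool) (p : A → Bool) xs ys →
    (∀ {x} → x ∈ xs → countᵇ (P x) ys ≡ indicator (p x)) → countCross P xs ys ≡ countᵇ p xs
  countCross-countᵇ P p []       ys _    = refl
  countCross-countᵇ P p (x ∷ xs) ys P≡p = trans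
    (cong₂ _+_ (P≡p (here refl)) (countCross-countᵇ P p xs ys (λ x∈ → P≡p (there x∈))))
    (sym (countᵇ-∷ p x xs))

  count₂≡0⇒ : ∀ (P : A → A → Bool) ws {y z zs} → count₂ P (ws ++ y ∷ zs) ≡ 0 → z ∈ zs → ¬ T (P y z)
  count₂≡0⇒ P []       {y} {zs = zs} c z∈zs = All.lookup (countᵇ≡0⇒none (P y) zs (ℕ.m+n≡0⇒m≡0 _ c)) z∈zs
  count₂≡0⇒ P (_ ∷ ws)              c z∈zs = count₂≡0⇒ P ws (ℕ.m+n≡0⇒n≡0 _ c) z∈zs

  count₃≡0⇒ : ∀ (P : A → A → A → Bool) xs {x y z zs} →
    count₃ P (xs ++ y ∷ zs) ≡ 0 → x ∈ xs → z ∈ zs → ¬ T (P x y z)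
  count₃≡0⇒ P (x ∷ xs) c (here refl)  z∈zs = count₂≡0⇒ (P x) xs (ℕ.m+n≡0⇒m≡0 _ c) z∈zs
  count₃≡0⇒ P (_ ∷ xs) c (there x∈xs) z∈zs = count₃≡0⇒ P xs (ℕ.m+n≡0⇒n≡0 _ c) x∈xs z∈zs

  Unique-concatMap⁺ : ∀ {A B : Set} (f : A → List B) (index : B → A) {xs} →
    (∀ {x y} → x ∈ xs → y ∈ f x → index y ≡ x) → Unique xs → (∀ {x} → x ∈ xs → Unique (f x)) →
    Unique (concatMap f xs)
  Unique-concatMap⁺ f index {[]}     _      _           _  = []
  Unique-concatMap⁺ f index {x ∷ xs} index≡ (x∉xs ∷ u) uf = Unique.++⁺
    (uf (here refl))
    (Unique-concatMap⁺ f index (λ x∈ → index≡ (there x∈)) u (λ x∈ → uf (there x∈)))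
    disjoint
    where
    disjoint : ∀ {y} → ¬ (y ∈ f x × y ∈ concatMap f xs)
    disjoint (y∈fx , y∈rest) with find (Mem.∈-concatMap⁻ f y∈rest)
    ... | x′ , x′∈xs , y∈fx′ =
      All.lookup x∉xs x′∈xs (trans (sym (index≡ (here refl) y∈fx)) (index≡ (there x′∈xs) y∈fx′))

  Unique-++⁻ : ∀ (xs : List A) {ys} → Unique (xs ++ ys) →
    Unique xs × Unique ys × (∀ {x y} → x ∈ xs → y ∈ ys → x ≢ y)
  Unique-++⁻ []       u        = [] , u , λ ()
  Unique-++⁻ (x ∷ xs) (x∉ ∷ u) with Unique-++⁻ xs u | All.++⁻ xs x∉
  ... | uxs , uys , disjoint | x∉xs , x∉ys = x∉xs ∷ uxs , uys , λ where
    (here refl)  y∈ys → All.lookup x∉ys y∈ys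
    (there x∈xs) y∈ys → disjoint x∈xs y∈ys

  ∈-concatMap⁺ : ∀ {B : Set} (f : A → List B) {x xs y} → x ∈ xs → y ∈ f x → y ∈ concatMap f xs
  ∈-concatMap⁺ f x∈xs y∈fx = Mem.∈-concatMap⁺ f (lose x∈xs y∈fx)

  ∈-concatMap⁻ : ∀ {B : Set} (f : A → List B) {xs y} → y ∈ concatMap f xs → ∃ λ x → x ∈ xs × y ∈ f x
  ∈-concatMap⁻ f y∈ = find (Mem.∈-concatMap⁻ f y∈)

  ∈-remove : ∀ {x y : A} xs ys → y ∈ xs ++ x ∷ ys → y ≢ x → y ∈ xs ++ ys
  ∈-remove []       ys (here y≡x) y≢x = ⊥-elim (y≢x y≡x)
  ∈-remove []       ys (there y∈) _   = y∈
  ∈-remove (z ∷ xs) ys (here y≡z) _   = here y≡z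
  ∈-remove (z ∷ xs) ys (there y∈) y≢x = there (∈-remove xs ys y∈ y≢x)

  unique-length-≤ : ∀ {xs ys : List A} → Unique xs → xs ⊆ ys → length xs ≤ length ys
  unique-length-≤ {xs = []}     _           _     = z≤n
  unique-length-≤ {xs = x ∷ xs} (x∉xs ∷ u) xs⊆ys with Mem.∈-∃++ (xs⊆ys (here refl))
  ... | ys₁ , ys₂ , refl = begin
    suc (length xs)           ≤⟨ s≤s (unique-length-≤ u xs⊆ys₁++ys₂) ⟩
    suc (length (ys₁ ++ ys₂)) ≡⟨ List.length-++-sucʳ ys₁ x ys₂ ⟨
    length (ys₁ ++ x ∷ ys₂)   ∎
    where
    open ℕ.≤-Reasoning
    xs⊆ys₁++ys₂ : xs ⊆ ys₁ ++ ys₂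
    xs⊆ys₁++ys₂ y∈xs = ∈-remove ys₁ ys₂ (xs⊆ys (there y∈xs)) (≢-sym (All.lookup x∉xs y∈xs))

  unique-bounded-length : ∀ {lo hi xs} → Unique xs → All (λ x → lo ≤ x × x < hi) xs → length xs ≤ hi ∸ lo
  unique-bounded-length {lo} {hi} u xs-in-range = ℕ.≤-trans
    (unique-length-≤ u (λ x∈xs → ∈-interval (All.lookup xs-in-range x∈xs)))
    (ℕ.≤-reflexive (List.length-applyUpTo (lo +_) (hi ∸ lo)))
    where
    ∈-interval : ∀ {x} → lo ≤ x × x < hi → x ∈ applyUpTo (lo +_) (hi ∸ lo)
    ∈-interval (lo≤x , x<hi) = subst (_∈ applyUpTo (lo +_) (hi ∸ lo)) (ℕ.m+[n∸m]≡n lo≤x)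
      (Mem.∈-applyUpTo⁺ (lo +_) (ℕ.∸-monoˡ-< x<hi lo≤x))

  take-length-++ : ∀ (xs ys : List A) → take (length xs) (xs ++ ys) ≡ xs
  take-length-++ []       ys = refl
  take-length-++ (x ∷ xs) ys = cong (x ∷_) (take-length-++ xs ys)

  position : ℕ → List ℕ → ℕ
  position v []       = 0
  position v (y ∷ ys) = if y ≡ᵇ v then 0 else suc (position v ys)

  position-++ : ∀ {v} xs ys → All (_≢ v) xs → position v (xs ++ v ∷ ys) ≡ length xs
  position-++ {v} [] ys [] with v ≡ᵇ v in eq
  ... | true  = refl
  ... | false = ⊥-elim (subst T eq (ℕ.≡⇒≡ᵇ v v refl))
  position-++ {v} (x ∷ xs) ys (x≢v ∷ xs≢v) with x ≡ᵇ v in eq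
  ... | true  = ⊥-elim (x≢v (ℕ.≡ᵇ⇒≡ x v (subst T (sym eq) _)))
  ... | false = cong suc (position-++ xs ys xs≢v)

  is123 : ℕ → ℕ → ℕ → Bool
  is123 x y z = (x <ᵇ y) ∧ (y <ᵇ z)

  is132 : ℕ → ℕ → ℕ → Bool
  is132 x y z = (x <ᵇ z) ∧ (z <ᵇ y)

  occ12 : List ℕ → ℕ
  occ12 = count₂ _<ᵇ_

  occ123 : List ℕ → ℕ
  occ123 = count₃ is123

  occ132 : List ℕ → ℕ
  occ132 = count₃ is132

  <ᵇ-shift : ∀ m x y → (m + x <ᵇ m + y) ≡ (x <ᵇ y)
  <ᵇ-shift zero    x y = refl
  <ᵇ-shift (suc m) x y = <ᵇ-shift m x y

  sum-indicator≡countᵇ : ∀ n (p : A → Bool) (f : Fin n → A) →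
    sum (λ j → indicator (p (f j))) ≡ countᵇ p (tabulate f)
  sum-indicator≡countᵇ zero    p f = refl
  sum-indicator≡countᵇ (suc n) p f = trans
    (cong (indicator (p (f Fin.zero)) +_) (sum-indicator≡countᵇ n p (f ∘ Fin.suc)))
    (sym (countᵇ-∷ p (f Fin.zero) (tabulate (f ∘ Fin.suc))))

  countᵇ-concatMap-tabulate : ∀ {B : Set} (p : B → Bool) (g : A → List B) n (h : Fin n → A) →
    countᵇ p (concatMap g (tabulate h)) ≡ sum (λ i → countᵇ p (g (h i)))
  countᵇ-concatMap-tabulate p g zero    h = refl
  countᵇ-concatMap-tabulate p g (suc n) h = trans
    (countᵇ-++ p (g (h Fin.zero)) _)
    (cong (countᵇ p (g (h Fin.zero)) +_) (countᵇ-concatMap-tabulate p g n (h ∘ Fin.suc)))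

  countᵇ-guard : ∀ (p : A → Bool) b x → countᵇ p (filterᵇ (λ _ → b) [ x ]) ≡ indicator (b ∧ p x)
  countᵇ-guard p false x = refl
  countᵇ-guard p true  x with p x
  ... | true  = refl
  ... | false = refl

  ⌊<?⌋≡<ᵇ : ∀ {n} (i j : Fin n) → ⌊ i Fin.<? j ⌋ ≡ (toℕ i <ᵇ toℕ j)
  ⌊<?⌋≡<ᵇ i j = isYes≗does (i Fin.<? j)

  ∑<₂ : ∀ {n} → (Fin n → Fin n → Bool) → ℕ
  ∑<₂ Q = sum λ i → sum λ j → indicator ((toℕ i <ᵇ toℕ j) ∧ Q i j)

  ∑<₃ : ∀ {n} → (Fin n → Fin n → Fin n → Bool) → ℕ
  ∑<₃ Q = sum λ i → sum λ j → sum λ k → indicator (((toℕ i <ᵇ toℕ j) ∧ (toℕ j <ᵇ toℕ k)) ∧ Q i j k)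

  ∑<₂-count₂ : ∀ n (P : A → A → Bool) (f : Fin n → A) →
    ∑<₂ (λ i j → P (f i) (f j)) ≡ count₂ P (tabulate f)
  ∑<₂-count₂ zero    P f = refl
  ∑<₂-count₂ (suc n) P f =
    cong₂ _+_ (sum-indicator≡countᵇ n (P (f Fin.zero)) (f ∘ Fin.suc)) (∑<₂-count₂ n P (f ∘ Fin.suc))

  -- Once comparisons are made on toℕ, every term involving the index 0 reduces by computation,
  -- except (b ∧ false), which needs ∧-zeroʳ.
  ∑<₃-count₃ : ∀ {A : Set} n (P : A → A → A → Bool) (f : Fin n → A) →
    ∑<₃ (λ i j k → P (f i) (f j) (f k)) ≡ count₃ P (tabulate f)
  ∑<₃-count₃ zero    P f = refl
  ∑<₃-count₃ {A} (suc n) P f = cong₂ _+_ first (trans rest (∑<₃-count₃ n P g))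
    where
    g : Fin n → A
    g = f ∘ Fin.suc
    first : (sum λ j → sum λ k → indicator (((0 <ᵇ toℕ j) ∧ (toℕ j <ᵇ toℕ k)) ∧ P (f Fin.zero) (f j) (f k)))
          ≡ count₂ (P (f Fin.zero)) (tabulate g)
    first = trans (cong (_+ ∑<₂ (λ i j → P (f Fin.zero) (g i) (g j))) (sum-replicate-zero (suc n)))
                  (∑<₂-count₂ n (P (f Fin.zero)) g)
    rest : (sum λ i → sum λ j → sum λ k →
             indicator (((suc (toℕ i) <ᵇ toℕ j) ∧ (toℕ j <ᵇ toℕ k)) ∧ P (g i) (f j) (f k)))
         ≡ ∑<₃ (λ i j k → P (g i) (g j) (g k))
    rest = sum-cong-≗ λ i → cong₂ _+_ (sum-replicate-zero (suc n)) (sum-cong-≗ λ j → cong₂ _+_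
             (cong (λ b → indicator (b ∧ P (g i) (g j) (f Fin.zero))) (∧-zeroʳ (toℕ i <ᵇ toℕ j))) refl)

  countᵇ-idx2 : ∀ n {Q : Fin n × Fin n → Bool} (P : A → A → Bool) (f : Fin n → A) →
    (∀ i j → Q (i , j) ≡ P (f i) (f j)) → countᵇ Q (idx2 n) ≡ count₂ P (tabulate f)
  countᵇ-idx2 n {Q} P f Q≡P = trans
    (trans (countᵇ-concatMap-tabulate Q _ n (λ i → i)) (sum-cong-≗ λ i →
     trans (countᵇ-concatMap-tabulate Q _ n (λ j → j)) (sum-cong-≗ λ j →
     trans (countᵇ-guard Q _ (i , j)) (cong₂ (λ b c → indicator (b ∧ c)) (⌊<?⌋≡<ᵇ i j) (Q≡P i j)))))
    (∑<₂-count₂ n P f)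

  countᵇ-idx3 : ∀ n {Q : Fin n × Fin n × Fin n → Bool} (P : A → A → A → Bool) (f : Fin n → A) →
    (∀ i j k → Q (i , j , k) ≡ P (f i) (f j) (f k)) → countᵇ Q (idx3 n) ≡ count₃ P (tabulate f)
  countᵇ-idx3 n {Q} P f Q≡P = trans
    (trans (countᵇ-concatMap-tabulate Q _ n (λ i → i)) (sum-cong-≗ λ i →
     trans (countᵇ-concatMap-tabulate Q _ n (λ j → j)) (sum-cong-≗ λ j →
     trans (countᵇ-concatMap-tabulate Q _ n (λ k → k)) (sum-cong-≗ λ k →
     trans (countᵇ-guard Q _ (i , j , k))
           (cong₂ (λ b c → indicator (b ∧ c)) (cong₂ _∧_ (⌊<?⌋≡<ᵇ i j) (⌊<?⌋≡<ᵇ j k)) (Q≡P i j k))))))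
    (∑<₃-count₃ n P f)

  values : ∀ {k n} → Vec (Fin k) n → List ℕ
  values π = tabulate (λ i → toℕ (lookup π i))

  count12≡occ12 : ∀ {n} (π : Vec (Fin n) n) → count12 π ≡ occ12 (values π)
  count12≡occ12 {n} π = countᵇ-idx2 n _<ᵇ_ _ (λ i j → ⌊<?⌋≡<ᵇ (lookup π i) (lookup π j))

  count123≡occ123 : ∀ {n} (π : Vec (Fin n) n) → count123 π ≡ occ123 (values π)
  count123≡occ123 {n} π = countᵇ-idx3 n is123 _ (λ i j k →
    cong₂ _∧_ (⌊<?⌋≡<ᵇ (lookup π i) (lookup π j)) (⌊<?⌋≡<ᵇ (lookup π j) (lookup π k)))

  count132≡occ132 : ∀ {n} (π : Vec (Fin n) n) → count132 π ≡ occ132 (values π)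
  count132≡occ132 {n} π = countᵇ-idx3 n is132 _ (λ i j k →
    cong₂ _∧_ (⌊<?⌋≡<ᵇ (lookup π i) (lookup π k)) (⌊<?⌋≡<ᵇ (lookup π k) (lookup π j)))

  unique⇔count₂≡ᵇ≡0 : ∀ {xs} → Unique xs ⇔ count₂ _≡ᵇ_ xs ≡ 0
  unique⇔count₂≡ᵇ≡0 {xs} = mk⇔
    (λ u → count₂-none _≡ᵇ_ (AllPairs.map (λ {x} {y} x≢y t → x≢y (ℕ.≡ᵇ⇒≡ x y t)) u))
    (λ c → AllPairs.map (λ {x} {y} ¬t x≡y → ¬t (ℕ.≡⇒≡ᵇ x y x≡y)) (count₂≡0⇒none _≡ᵇ_ xs c))

  T-isZero : ∀ {m} → T (isZero m) ⇔ m ≡ 0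
  T-isZero {zero}  = mk⇔ (λ _ → refl) _
  T-isZero {suc m} = mk⇔ (λ ()) (λ ())

  allᵇ≡isZero-count : ∀ (Q : A → Bool) xs → allᵇ Q xs ≡ isZero (countᵇ (not ∘ Q) xs)
  allᵇ≡isZero-count Q []       = refl
  allᵇ≡isZero-count Q (x ∷ xs) with Q x
  ... | true  = allᵇ≡isZero-count Q xs
  ... | false = refl

  isPerm≡ : ∀ {n} (π : Vec (Fin n) n) → isPerm π ≡ isZero (count₂ _≡ᵇ_ (values π))
  isPerm≡ {n} π = trans (allᵇ≡isZero-count _ (idx2 n)) (cong isZero (countᵇ-idx2 n _≡ᵇ_ _ λ i j →
    trans (not-involutive _) (⌊≟⌋≡≡ᵇ (lookup π i) (lookup π j))))
    where
    ⌊≟⌋≡≡ᵇ : ∀ (x y : Fin n) → ⌊ x Fin.≟ y ⌋ ≡ (toℕ x ≡ᵇ toℕ y)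
    ⌊≟⌋≡≡ᵇ x y = trans (isYes≗does (x Fin.≟ y))
      (does-⇔ (mk⇔ (cong toℕ) Fin.toℕ-injective) (x Fin.≟ y) (toℕ x ℕ.≟ toℕ y))

  -- 132-avoiding permutations as lists

  record IsPermutation (n : ℕ) (xs : List ℕ) : Set where
    constructor isPermutation
    field
      unique  : Unique xs
      bounded : All (_< n) xs
      length≡ : length xs ≡ n

  Avoider : ℕ → List ℕ → Set
  Avoider n xs = IsPermutation n xs × occ132 xs ≡ 0

  ∈-words : ∀ n k (v : Vec (Fin k) n) → v ∈ words n k
  ∈-words zero    k []      = here refl
  ∈-words (suc n) k (x ∷ v) =
    ∈-concatMap⁺ (λ x → map (x ∷_) (words n k)) (Mem.∈-allFin x) (Mem.∈-map⁺ (x ∷_) (∈-words n k v))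

  words-unique : ∀ n k → Unique (words n k)
  words-unique zero    k = [] ∷ []
  words-unique (suc n) k = Unique-concatMap⁺ _ Vec.head head≡ (Unique.allFin⁺ k)
    (λ _ → Unique.map⁺ Vec.∷-injectiveʳ (words-unique n k))
    where
    head≡ : ∀ {x v} → x ∈ allFin k → v ∈ map (x ∷_) (words n k) → Vec.head v ≡ x
    head≡ _ v∈ with Mem.∈-map⁻ _ v∈
    ... | _ , _ , refl = refl

  values-bounded : ∀ {k n} (π : Vec (Fin k) n) → All (_< k) (values π)
  values-bounded []      = []
  values-bounded (x ∷ π) = Fin.toℕ<n x ∷ values-bounded π

  values-injective : ∀ {k n} {π ρ : Vec (Fin k) n} → values π ≡ values ρ → π ≡ ρ
  values-injective {π = []}    {[]}    _ = refl
  values-injective {π = x ∷ π} {y ∷ ρ} e =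
    cong₂ _∷_ (Fin.toℕ-injective (List.∷-injectiveˡ e)) (values-injective (List.∷-injectiveʳ e))

  fromBounded : ∀ {k} xs → All (_< k) xs → Vec (Fin k) (length xs)
  fromBounded []       []           = []
  fromBounded (x ∷ xs) (x<k ∷ xs<k) = Fin.fromℕ< x<k ∷ fromBounded xs xs<k

  values-fromBounded : ∀ {k} xs (xs<k : All (_< k) xs) → values (fromBounded xs xs<k) ≡ xs
  values-fromBounded []       []           = refl
  values-fromBounded (x ∷ xs) (x<k ∷ xs<k) = cong₂ _∷_ (Fin.toℕ-fromℕ< x<k) (values-fromBounded xs xs<k)

  isAvoider : ∀ {n} → Vec (Fin n) n → Bool
  isAvoider π = isPerm π ∧ isZero (count132 π)

  T-isAvoider : ∀ {n} (π : Vec (Fin n) n) →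
    T (isAvoider π) ⇔ (Unique (values π) × occ132 (values π) ≡ 0)
  T-isAvoider π rewrite isPerm≡ π | count132≡occ132 π = mk⇔
    (λ t → let u , c = Equivalence.to T-∧ t
           in Equivalence.from unique⇔count₂≡ᵇ≡0 (Equivalence.to T-isZero u) , Equivalence.to T-isZero c)
    (λ (u , c) → Equivalence.from T-∧
       (Equivalence.from T-isZero (Equivalence.to unique⇔count₂≡ᵇ≡0 u) , Equivalence.from T-isZero c))

  avoiderLists : ℕ → List (List ℕ)
  avoiderLists n = map values (avoiders132 n)

  avoiderLists-unique : ∀ n → Unique (avoiderLists n)
  avoiderLists-unique n =
    Unique.map⁺ values-injective (Unique.filter⁺ (T? ∘ isAvoider) (words-unique n n))

  ∈avoiderLists⁻ : ∀ {n xs} → xs ∈ avoiderLists n → Avoider n xs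
  ∈avoiderLists⁻ xs∈ with Mem.∈-map⁻ values xs∈
  ... | π , π∈ , refl
    with Equivalence.to (T-isAvoider π) (proj₂ (Mem.∈-filter⁻ (T? ∘ isAvoider) {xs = words _ _} π∈))
  ... | u , c = isPermutation u (values-bounded π) (List.length-tabulate _) , c

  ∈avoiderLists⁺ : ∀ {n xs} → Avoider n xs → xs ∈ avoiderLists n
  ∈avoiderLists⁺ {xs = xs} (isPermutation u xs<n refl , c) =
    subst (_∈ avoiderLists (length xs)) values≡ (Mem.∈-map⁺ values
      (Mem.∈-filter⁺ (T? ∘ isAvoider) (∈-words _ _ π)
        (Equivalence.from (T-isAvoider π) (subst (λ ys → Unique ys × occ132 ys ≡ 0) (sym values≡) (u , c)))))
    where
    π : Vec (Fin (length xs)) (length xs)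
    π = fromBounded xs xs<n
    values≡ : values π ≡ xs
    values≡ = values-fromBounded xs xs<n

  -- Decomposition at the maximum

  glue : ℕ → ℕ → List ℕ → List ℕ → List ℕ
  glue k m α β = map (m +_) α ++ (m + k) ∷ β

  -- In A ++ K ∷ β with β < m ≤ A < K, the only occurrences meeting two of the three parts are the
  -- pairs (a , K) and the 123-triples (a , a′ , K); no 132 meets two parts.
  module Block {m K : ℕ} {β : List ℕ} (β<m : All (_< m) β) (m≤K : m ≤ K) where

    InRange : ℕ → Set
    InRange a = m ≤ a × a < K

    private
      ∧ˡ : ∀ {b c} → T (b ∧ c) → T b
      ∧ˡ t = proj₁ (Equivalence.to T-∧ t)

      ∧ʳ : ∀ {b c} → T (b ∧ c) → T c
      ∧ʳ t = proj₂ (Equivalence.to T-∧ t)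

      ¬<ᵇβ : ∀ {x b} → m ≤ x → b ∈ β → ¬ T (x <ᵇ b)
      ¬<ᵇβ m≤x b∈β t = ℕ.<-asym (ℕ.<ᵇ⇒< _ _ t) (ℕ.<-≤-trans (All.lookup β<m b∈β) m≤x)

      ¬K<ᵇ : ∀ {y} → y < K → ¬ T (K <ᵇ y)
      ¬K<ᵇ y<K t = ℕ.<-asym (ℕ.<ᵇ⇒< _ _ t) y<K

      ¬K<ᵇK∷β : ∀ {y} → y ∈ K ∷ β → ¬ T (K <ᵇ y)
      ¬K<ᵇK∷β (here refl) t = ℕ.<-irrefl refl (ℕ.<ᵇ⇒< K K t)
      ¬K<ᵇK∷β (there b∈β) = ¬<ᵇβ m≤K b∈β

    occ12-block : ∀ A → All InRange A → occ12 (A ++ K ∷ β) ≡ occ12 A + length A + occ12 β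
    occ12-block []      _ = cong (_+ occ12 β) (countᵇ-none (K <ᵇ_) (All.tabulate (¬<ᵇβ m≤K)))
    occ12-block (a ∷ A) ((m≤a , a<K) ∷ A-in) = begin
      countᵇ (a <ᵇ_) (A ++ K ∷ β) + occ12 (A ++ K ∷ β)
        ≡⟨ cong₂ _+_ (countᵇ-++ (a <ᵇ_) A (K ∷ β)) (occ12-block A A-in) ⟩
      (countᵇ (a <ᵇ_) A + countᵇ (a <ᵇ_) (K ∷ β)) + (occ12 A + length A + occ12 β)
        ≡⟨ cong (λ c → (countᵇ (a <ᵇ_) A + c) + (occ12 A + length A + occ12 β)) a<K∷β ⟩
      (countᵇ (a <ᵇ_) A + 1) + (occ12 A + length A + occ12 β)
        ≡⟨ solve 4 (λ c o l b → (c :+ con 1) :+ ((o :+ l) :+ b) := ((c :+ o) :+ (con 1 :+ l)) :+ b) refl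
             (countᵇ (a <ᵇ_) A) (occ12 A) (length A) (occ12 β) ⟩
      (countᵇ (a <ᵇ_) A + occ12 A) + suc (length A) + occ12 β ∎
      where
      open ≡-Reasoning
      a<K∷β : countᵇ (a <ᵇ_) (K ∷ β) ≡ 1
      a<K∷β = trans (countᵇ-accept (a <ᵇ_) K β (ℕ.<⇒<ᵇ a<K))
                    (cong suc (countᵇ-none (a <ᵇ_) (All.tabulate (¬<ᵇβ m≤a))))

    occ123-block : ∀ A → All InRange A → occ123 (A ++ K ∷ β) ≡ occ123 A + occ12 A + occ123 β
    occ123-block []      _ = cong (_+ occ123 β) (count₂-vanish (is123 K) β (λ y∈β _ t → ¬<ᵇβ m≤K y∈β (∧ˡ t)))
    occ123-block (a ∷ A) ((m≤a , a<K) ∷ A-in) = begin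
      count₂ (is123 a) (A ++ K ∷ β) + occ123 (A ++ K ∷ β)
        ≡⟨ cong₂ _+_ (count₂-++ (is123 a) A (K ∷ β)) (occ123-block A A-in) ⟩
      (count₂ (is123 a) A + countCross (is123 a) A (K ∷ β) + count₂ (is123 a) (K ∷ β))
        + (occ123 A + occ12 A + occ123 β)
        ≡⟨ cong₂ (λ c d → (count₂ (is123 a) A + c + d) + (occ123 A + occ12 A + occ123 β)) cross vanish ⟩
      (count₂ (is123 a) A + countᵇ (a <ᵇ_) A + 0) + (occ123 A + occ12 A + occ123 β)
        ≡⟨ solve 5 (λ p c t u v → ((p :+ c) :+ con 0) :+ ((t :+ u) :+ v) := ((p :+ t) :+ (c :+ u)) :+ v) refl
             (count₂ (is123 a) A) (countᵇ (a <ᵇ_) A) (occ123 A) (occ12 A) (occ123 β) ⟩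
      (count₂ (is123 a) A + occ123 A) + (countᵇ (a <ᵇ_) A + occ12 A) + occ123 β ∎
      where
      open ≡-Reasoning
      middle : ∀ {y} → InRange y → countᵇ (is123 a y) (K ∷ β) ≡ indicator (a <ᵇ y)
      middle {y} (m≤y , y<K) = begin
        countᵇ (is123 a y) (K ∷ β)
          ≡⟨ countᵇ-∷ (is123 a y) K β ⟩
        indicator ((a <ᵇ y) ∧ (y <ᵇ K)) + countᵇ (is123 a y) β
          ≡⟨ cong₂ (λ b c → indicator ((a <ᵇ y) ∧ b) + c) (Equivalence.to T-≡ (ℕ.<⇒<ᵇ y<K))
               (countᵇ-none (is123 a y) (All.tabulate (λ b∈β t → ¬<ᵇβ m≤y b∈β (∧ʳ t)))) ⟩
        indicator ((a <ᵇ y) ∧ true) + 0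
          ≡⟨ trans (ℕ.+-identityʳ _) (cong indicator (∧-identityʳ (a <ᵇ y))) ⟩
        indicator (a <ᵇ y) ∎
      cross : countCross (is123 a) A (K ∷ β) ≡ countᵇ (a <ᵇ_) A
      cross = countCross-countᵇ (is123 a) (a <ᵇ_) A (K ∷ β) (λ y∈A → middle (All.lookup A-in y∈A))
      vanish : count₂ (is123 a) (K ∷ β) ≡ 0
      vanish = count₂-vanish (is123 a) (K ∷ β) λ where
        (here refl) z∈ t → ¬K<ᵇK∷β z∈ (∧ʳ t)
        (there y∈β) _  t → ¬<ᵇβ m≤a y∈β (∧ˡ t)

    occ132-block : ∀ A → All InRange A → occ132 (A ++ K ∷ β) ≡ occ132 A + occ132 β
    occ132-block []      _ = cong (_+ occ132 β) (count₂-vanish (is132 K) β (λ _ z∈β t → ¬<ᵇβ m≤K z∈β (∧ˡ t)))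
    occ132-block (a ∷ A) ((m≤a , a<K) ∷ A-in) = begin
      count₂ (is132 a) (A ++ K ∷ β) + occ132 (A ++ K ∷ β)
        ≡⟨ cong₂ _+_ (count₂-++ (is132 a) A (K ∷ β)) (occ132-block A A-in) ⟩
      (count₂ (is132 a) A + countCross (is132 a) A (K ∷ β) + count₂ (is132 a) (K ∷ β))
        + (occ132 A + occ132 β)
        ≡⟨ cong₂ (λ c d → (count₂ (is132 a) A + c + d) + (occ132 A + occ132 β)) cross vanish ⟩
      (count₂ (is132 a) A + 0 + 0) + (occ132 A + occ132 β)
        ≡⟨ solve 3 (λ p t v → ((p :+ con 0) :+ con 0) :+ (t :+ v) := (p :+ t) :+ v) refl
             (count₂ (is132 a) A) (occ132 A) (occ132 β) ⟩
      (count₂ (is132 a) A + occ132 A) + occ132 β ∎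
      where
      open ≡-Reasoning
      cross : countCross (is132 a) A (K ∷ β) ≡ 0
      cross = countCross-vanish (is132 a) A (K ∷ β) λ where
        y∈A (here refl) t → ¬K<ᵇ (proj₂ (All.lookup A-in y∈A)) (∧ʳ t)
        _   (there z∈β) t → ¬<ᵇβ m≤a z∈β (∧ˡ t)
      vanish : count₂ (is132 a) (K ∷ β) ≡ 0
      vanish = count₂-vanish (is132 a) (K ∷ β) λ where
        y∈ (here refl) t → ¬K<ᵇK∷β y∈ (∧ʳ t)
        _  (there z∈β) t → ¬<ᵇβ m≤a z∈β (∧ˡ t)

  module _ {k m : ℕ} {α β : List ℕ} (α<k : All (_< k) α) (β<m : All (_< m) β) where

    private
      open Block β<m (ℕ.m≤m+n m k)

      shifted-in-range : All InRange (map (m +_) α)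
      shifted-in-range = All.map⁺ (All.map (λ a<k → ℕ.m≤m+n m _ , ℕ.+-monoʳ-< m a<k) α<k)

    occ12-glue : occ12 (glue k m α β) ≡ occ12 α + length α + occ12 β
    occ12-glue = trans (occ12-block (map (m +_) α) shifted-in-range)
      (cong₂ (λ c l → c + l + occ12 β)
        (count₂-map _<ᵇ_ _<ᵇ_ (m +_) α (<ᵇ-shift m))
        (List.length-map (m +_) α))

    occ123-glue : occ123 (glue k m α β) ≡ occ123 α + occ12 α + occ123 β
    occ123-glue = trans (occ123-block (map (m +_) α) shifted-in-range)
      (cong₂ (λ c d → c + d + occ123 β)
        (count₃-map is123 is123 (m +_) α (λ x y z → cong₂ _∧_ (<ᵇ-shift m x y) (<ᵇ-shift m y z)))
        (count₂-map _<ᵇ_ _<ᵇ_ (m +_) α (<ᵇ-shift m)))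

    occ132-glue : occ132 (glue k m α β) ≡ occ132 α + occ132 β
    occ132-glue = trans (occ132-block (map (m +_) α) shifted-in-range)
      (cong (_+ occ132 β)
        (count₃-map is132 is132 (m +_) α (λ x y z → cong₂ _∧_ (<ᵇ-shift m x z) (<ᵇ-shift m z y))))

  glue-isPermutation : ∀ {k m α β} → IsPermutation k α → IsPermutation m β →
    IsPermutation (suc (m + k)) (glue k m α β)
  glue-isPermutation {k} {m} {α} {β} (isPermutation uα α<k lα) (isPermutation uβ β<m lβ) =
    isPermutation unique bounded length≡
    where
    β<m+k : ∀ {b} → b ∈ β → b < m + k
    β<m+k b∈β = ℕ.<-≤-trans (All.lookup β<m b∈β) (ℕ.m≤m+n m k)
    disjoint : ∀ {v} → ¬ (v ∈ map (m +_) α × v ∈ (m + k) ∷ β)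
    disjoint (v∈ , v∈′) with Mem.∈-map⁻ (m +_) v∈
    disjoint (_ , here m+a≡m+k) | a , a∈α , refl =
      ℕ.<-irrefl (ℕ.+-cancelˡ-≡ m a k m+a≡m+k) (All.lookup α<k a∈α)
    disjoint (_ , there v∈β)    | a , a∈α , refl =
      ℕ.<-irrefl refl (ℕ.<-≤-trans (All.lookup β<m v∈β) (ℕ.m≤m+n m a))
    unique : Unique (glue k m α β)
    unique = Unique.++⁺ (Unique.map⁺ (ℕ.+-cancelˡ-≡ m _ _) uα)
      (All.tabulate (λ b∈β m+k≡b → ℕ.<-irrefl (sym m+k≡b) (β<m+k b∈β)) ∷ uβ) disjoint
    bounded : All (_< suc (m + k)) (glue k m α β)
    bounded = All.++⁺ (All.map⁺ (All.map (λ a<k → ℕ.m<n⇒m<1+n (ℕ.+-monoʳ-< m a<k)) α<k))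
      (ℕ.≤-refl ∷ All.tabulate (λ b∈β → ℕ.m<n⇒m<1+n (β<m+k b∈β)))
    length≡ : length (glue k m α β) ≡ suc (m + k)
    length≡ = begin
      length (map (m +_) α ++ (m + k) ∷ β)  ≡⟨ List.length-++ (map (m +_) α) ⟩
      length (map (m +_) α) + suc (length β)
        ≡⟨ cong₂ (λ a b → a + suc b) (trans (List.length-map (m +_) α) lα) lβ ⟩
      k + suc m                             ≡⟨ trans (ℕ.+-suc k m) (cong suc (ℕ.+-comm k m)) ⟩
      suc (m + k)                           ∎
      where open ≡-Reasoning

  glue-avoider : ∀ {k m α β} → Avoider k α → Avoider m β → Avoider (suc (m + k)) (glue k m α β)
  glue-avoider (pα , cα) (pβ , cβ) =
    glue-isPermutation pα pβ ,
    trans (occ132-glue (IsPermutation.bounded pα) (IsPermutation.bounded pβ)) (cong₂ _+_ cα cβ)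

  max∈ : ∀ {n xs} → IsPermutation (suc n) xs → n ∈ xs
  max∈ {n} {xs} (isPermutation u xs<1+n len) with n ∈? xs
  ... | yes n∈xs = n∈xs
  ... | no  n∉xs = ⊥-elim (ℕ.1+n≰n (subst (_≤ n) len (unique-bounded-length u (All.tabulate below))))
    where
    below : ∀ {x} → x ∈ xs → 0 ≤ x × x < n
    below x∈xs = z≤n , ℕ.≤∧≢⇒< (ℕ.≤-pred (All.lookup xs<1+n x∈xs)) (λ { refl → n∉xs x∈xs })

  data Glued (n : ℕ) : List ℕ → Set where
    glued : ∀ {k m α β} → m + k ≡ n → Avoider k α → Avoider m β → Glued n (glue k m α β)

  module Decomposition {n : ℕ} (as bs : List ℕ)
    (u : Unique (as ++ n ∷ bs)) (bd : All (_< suc n) (as ++ n ∷ bs))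
    (len : length (as ++ n ∷ bs) ≡ suc n) (c : occ132 (as ++ n ∷ bs) ≡ 0) where

    private
      k m : ℕ
      k = length as
      m = length bs

      m+k≡n : m + k ≡ n
      m+k≡n = ℕ.suc-injective (begin
        suc (m + k)              ≡⟨ cong suc (ℕ.+-comm m k) ⟩
        suc (k + m)              ≡⟨ cong suc (List.length-++ as) ⟨
        suc (length (as ++ bs))  ≡⟨ List.length-++-sucʳ as n bs ⟨
        length (as ++ n ∷ bs)    ≡⟨ len ⟩
        suc n                    ∎)
        where open ≡-Reasoning

      uas : Unique as
      uas = proj₁ (Unique-++⁻ as u)

      n∉bs : All (n ≢_) bs
      n∉bs with proj₁ (proj₂ (Unique-++⁻ as u))
      ... | n∉bs ∷ _ = n∉bs

      ubs : Unique bs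
      ubs with proj₁ (proj₂ (Unique-++⁻ as u))
      ... | _ ∷ ubs = ubs

      as≢bs : ∀ {a y} → a ∈ as → y ∈ n ∷ bs → a ≢ y
      as≢bs = proj₂ (proj₂ (Unique-++⁻ as u))

      as<n : All (_< n) as
      as<n = All.tabulate λ a∈as →
        ℕ.≤∧≢⇒< (ℕ.≤-pred (All.lookup (All.++⁻ˡ as bd) a∈as)) (as≢bs a∈as (here refl))

      bs<n : All (_< n) bs
      bs<n with All.++⁻ʳ as bd
      ... | _ ∷ bs<1+n = All.tabulate λ b∈bs →
        ℕ.≤∧≢⇒< (ℕ.≤-pred (All.lookup bs<1+n b∈bs)) (≢-sym (All.lookup n∉bs b∈bs))

      -- Otherwise a , n , b would be an occurrence of 132.
      bs<as : ∀ {a b} → a ∈ as → b ∈ bs → b < a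
      bs<as {a} {b} a∈as b∈bs = ℕ.≤∧≢⇒< (ℕ.≮⇒≥ a≮b) (≢-sym (as≢bs a∈as (there b∈bs)))
        where
        a≮b : ¬ a < b
        a≮b a<b = count₃≡0⇒ is132 as c a∈as b∈bs
          (Equivalence.from T-∧ (ℕ.<⇒<ᵇ a<b , ℕ.<⇒<ᵇ (All.lookup bs<n b∈bs)))

      -- The k distinct values of as all lie strictly between b and n.
      bs<m : All (_< m) bs
      bs<m = All.tabulate λ {b} b∈bs → ℕ.+-cancelˡ-≤ k (suc b) m (begin
        k + suc b          ≤⟨ ℕ.+-monoˡ-≤ (suc b) (unique-bounded-length uas
                                (All.tabulate λ a∈as → bs<as a∈as b∈bs , All.lookup as<n a∈as)) ⟩
        n ∸ suc b + suc b  ≡⟨ ℕ.m∸n+n≡m (All.lookup bs<n b∈bs) ⟩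
        n                  ≡⟨ trans (ℕ.+-comm k m) m+k≡n ⟨
        k + m              ∎)
        where open ℕ.≤-Reasoning

      -- The m distinct values of bs all lie below a.
      m≤as : All (m ≤_) as
      m≤as = All.tabulate λ a∈as → unique-bounded-length ubs (All.tabulate λ b∈bs → z≤n , bs<as a∈as b∈bs)

      α : List ℕ
      α = map (_∸ m) as

      shift : map (m +_) α ≡ as
      shift = trans (sym (List.map-∘ as)) (List.map-id-local (All.map ℕ.m+[n∸m]≡n m≤as))

      glue≡ : glue k m α bs ≡ as ++ n ∷ bs
      glue≡ = cong₂ (λ A K → A ++ K ∷ bs) shift m+k≡n

      α<k : All (_< k) α
      α<k = All.map⁺ (All.tabulate λ {a} a∈as → subst (a ∸ m <_) (ℕ.m+n∸m≡n m k)
        (ℕ.∸-monoˡ-< (subst (a <_) (sym m+k≡n) (All.lookup as<n a∈as)) (All.lookup m≤as a∈as)))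

      occ132-parts : occ132 α + occ132 bs ≡ 0
      occ132-parts = trans (sym (occ132-glue α<k bs<m)) (trans (cong occ132 glue≡) c)

    glued-at : Glued n (as ++ n ∷ bs)
    glued-at = subst (Glued n) glue≡ (glued m+k≡n
      (isPermutation (Unique.map⁻ (subst Unique (sym shift) uas)) α<k (List.length-map _ as) ,
       ℕ.m+n≡0⇒m≡0 _ occ132-parts)
      (isPermutation ubs bs<m refl , ℕ.m+n≡0⇒n≡0 _ occ132-parts))

  decompose : ∀ {n xs} → Avoider (suc n) xs → Glued n xs
  decompose (p@(isPermutation u bd len) , c) with Mem.∈-∃++ (max∈ p)
  ... | as , bs , refl = Decomposition.glued-at as bs u bd len c

  -- Enumerating the decompositions

  gluings : ℕ → ℕ → List (List ℕ)
  gluings k m = concatMap (λ α → map (glue k m α) (avoiderLists m)) (avoiderLists k)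

  allGluings : ℕ → List (List ℕ)
  allGluings n = concatMap (λ k → gluings k (n ∸ k)) (upTo (suc n))

  ∈allGluings⁻ : ∀ {n ys} → ys ∈ allGluings n → Avoider (suc n) ys
  ∈allGluings⁻ {n} ys∈ with ∈-concatMap⁻ (λ k → gluings k (n ∸ k)) ys∈
  ... | k , k∈ , ys∈gluings
    with ∈-concatMap⁻ (λ α → map (glue k (n ∸ k) α) (avoiderLists (n ∸ k))) ys∈gluings
  ... | α , α∈ , ys∈map with Mem.∈-map⁻ (glue k (n ∸ k) α) ys∈map
  ... | β , β∈ , refl =
    subst (λ N → Avoider (suc N) (glue k (n ∸ k) α β)) (ℕ.m∸n+n≡m (ℕ.≤-pred (Mem.∈-upTo⁻ k∈)))
      (glue-avoider (∈avoiderLists⁻ α∈) (∈avoiderLists⁻ β∈))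

  ∈allGluings⁺ : ∀ {n ys} → Avoider (suc n) ys → ys ∈ allGluings n
  ∈allGluings⁺ a with decompose a
  ... | glued {k} {m} {α} {β} refl aα aβ =
    ∈-concatMap⁺ (λ k′ → gluings k′ (m + k ∸ k′)) (Mem.∈-upTo⁺ (s≤s (ℕ.m≤n+m k m)))
      (subst (λ m′ → glue k m α β ∈ gluings k m′) (sym (ℕ.m+n∸n≡m m k))
        (∈-concatMap⁺ (λ α′ → map (glue k m α′) (avoiderLists m)) (∈avoiderLists⁺ aα)
          (Mem.∈-map⁺ (glue k m α) (∈avoiderLists⁺ aβ))))

  gluings-unique : ∀ k m → Unique (gluings k m)
  gluings-unique k m =
    Unique-concatMap⁺ _ (λ ys → map (_∸ m) (take k ys)) prefix≡ (avoiderLists-unique k)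
      (λ _ → Unique.map⁺ (λ e → List.∷-injectiveʳ (List.++-cancelˡ (map (m +_) _) _ _ e)) (avoiderLists-unique m))
    where
    prefix≡ : ∀ {α ys} → α ∈ avoiderLists k → ys ∈ map (glue k m α) (avoiderLists m) →
      map (_∸ m) (take k ys) ≡ α
    prefix≡ {α} α∈ ys∈ with Mem.∈-map⁻ (glue k m α) ys∈ | ∈avoiderLists⁻ α∈
    ... | β , _ , refl | isPermutation _ _ refl , _ = begin
      map (_∸ m) (take (length α) (glue (length α) m α β))
        ≡⟨ cong (λ l → map (_∸ m) (take l (glue (length α) m α β))) (List.length-map (m +_) α) ⟨
      map (_∸ m) (take (length (map (m +_) α)) (glue (length α) m α β))
        ≡⟨ cong (map (_∸ m)) (take-length-++ (map (m +_) α) _) ⟩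
      map (_∸ m) (map (m +_) α)
        ≡⟨ List.map-∘ α ⟨
      map (λ a → m + a ∸ m) α
        ≡⟨ trans (List.map-cong (ℕ.m+n∸m≡n m) α) (List.map-id α) ⟩
      α ∎
      where open ≡-Reasoning

  allGluings-unique : ∀ n → Unique (allGluings n)
  allGluings-unique n =
    Unique-concatMap⁺ _ (position n) position≡ (Unique.upTo⁺ (suc n)) (λ {k} _ → gluings-unique k (n ∸ k))
    where
    position≡ : ∀ {k ys} → k ∈ upTo (suc n) → ys ∈ gluings k (n ∸ k) → position n ys ≡ k
    position≡ {k} k∈ ys∈ with ∈-concatMap⁻ (λ α → map (glue k (n ∸ k) α) (avoiderLists (n ∸ k))) ys∈
    ... | α , α∈ , ys∈map with Mem.∈-map⁻ (glue k (n ∸ k) α) ys∈map | ∈avoiderLists⁻ {k} α∈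
    ... | β , _ , refl | isPermutation _ α<k refl , _ = begin
      position n (map (n ∸ k +_) α ++ (n ∸ k + k) ∷ β)
        ≡⟨ cong (λ K → position n (map (n ∸ k +_) α ++ K ∷ β)) max≡n ⟩
      position n (map (n ∸ k +_) α ++ n ∷ β)
        ≡⟨ position-++ (map (n ∸ k +_) α) β shifted≢n ⟩
      length (map (n ∸ k +_) α)
        ≡⟨ List.length-map _ α ⟩
      length α ∎
      where
      open ≡-Reasoning
      max≡n : n ∸ k + k ≡ n
      max≡n = ℕ.m∸n+n≡m (ℕ.≤-pred (Mem.∈-upTo⁻ k∈))
      shifted≢n : All (_≢ n) (map (n ∸ k +_) α)
      shifted≢n = All.map⁺ (All.map (λ a<k e → ℕ.<-irrefl (trans e (sym max≡n)) (ℕ.+-monoʳ-< (n ∸ k) a<k)) α<k)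

module WeightedSums {c ℓ} (R : CommutativeSemiring c ℓ) where

  open import Data.List using (List; []; _∷_; _++_; map; concatMap; upTo; applyUpTo)
  import Data.List.Properties as List
  open import Data.List.Membership.Propositional using (_∈_)
  open import Data.List.Membership.Propositional.Properties.WithK using (unique∧set⇒bag)
  open import Data.List.Relation.Binary.BagAndSetEquality using (∼bag⇒↭)
  open import Data.List.Relation.Binary.Permutation.Propositional using (_↭_; ↭⇒↭ₛ′)
  import Data.List.Relation.Binary.Permutation.Propositional.Properties as Permutation
  import Data.List.Relation.Binary.Permutation.Setoid.Properties as PermutationSetoid
  open import Data.List.Relation.Unary.Any using (here; there)
  open import Data.List.Relation.Unary.Unique.Propositional using (Unique)
  import Data.Nat as ℕ
  open import Data.Nat using (_∸_)
  open import Data.Product using (_,_)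
  open import Function.Bundles using (_⇔_; mk⇔)
  open import Relation.Binary.PropositionalEquality as ≡ using (_≡_)

  open CommutativeSemiring R
  open import Algebra.Properties.CommutativeSemiring.Exp R using (_^_; ^-homo-*; ^-distrib-*)
  import Algebra.Solver.CommutativeMonoid *-commutativeMonoid as *-Solver
  open import Relation.Binary.Reasoning.Setoid setoid
  open Series R
  open Permutations

  private
    variable
      A : Set

  sumR-++ : ∀ (f : A → Carrier) xs ys → sumR (map f (xs ++ ys)) ≈ sumR (map f xs) + sumR (map f ys)
  sumR-++ f []       ys = sym (+-identityˡ _)
  sumR-++ f (x ∷ xs) ys = trans (+-congˡ (sumR-++ f xs ys)) (sym (+-assoc _ _ _))

  sumR-concatMap : ∀ {B : Set} (f : B → Carrier) (g : A → List B) xs →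
    sumR (map f (concatMap g xs)) ≈ sumR (map (λ x → sumR (map f (g x))) xs)
  sumR-concatMap f g []       = refl
  sumR-concatMap f g (x ∷ xs) =
    trans (sumR-++ f (g x) (concatMap g xs)) (+-congˡ (sumR-concatMap f g xs))

  sumR-cong : ∀ {f g : A → Carrier} {xs} → (∀ {x} → x ∈ xs → f x ≈ g x) →
    sumR (map f xs) ≈ sumR (map g xs)
  sumR-cong {xs = []}     _   = refl
  sumR-cong {xs = x ∷ xs} f≈g = +-cong (f≈g (here ≡.refl)) (sumR-cong (λ x∈ → f≈g (there x∈)))

  *-distribˡ-sumR : ∀ a (f : A → Carrier) xs → a * sumR (map f xs) ≈ sumR (map (λ x → a * f x) xs)
  *-distribˡ-sumR a f []       = zeroʳ a
  *-distribˡ-sumR a f (x ∷ xs) = trans (distribˡ a _ _) (+-congˡ (*-distribˡ-sumR a f xs))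

  *-distribʳ-sumR : ∀ a (f : A → Carrier) xs → sumR (map f xs) * a ≈ sumR (map (λ x → f x * a) xs)
  *-distribʳ-sumR a f []       = zeroˡ a
  *-distribʳ-sumR a f (x ∷ xs) = trans (distribʳ a _ _) (+-congˡ (*-distribʳ-sumR a f xs))

  sumR-↭ : ∀ (f : A → Carrier) {xs ys} → xs ↭ ys → sumR (map f xs) ≈ sumR (map f ys)
  sumR-↭ f xs↭ys = PermutationSetoid.foldr-commMonoid setoid +-isCommutativeMonoid
    (↭⇒↭ₛ′ isEquivalence (Permutation.map⁺ f xs↭ys))

  sumR-reindex : ∀ (f : A → Carrier) {xs ys} → Unique xs → Unique ys → (∀ {z} → z ∈ xs ⇔ z ∈ ys) →
    sumR (map f xs) ≈ sumR (map f ys)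
  sumR-reindex f uxs uys same = sumR-↭ f (∼bag⇒↭ (unique∧set⇒bag uxs uys same))

  pow≡^ : ∀ x n → pow x n ≡ x ^ n
  pow≡^ x zero    = ≡.refl
  pow≡^ x (suc n) = ≡.cong (x *_) (pow≡^ x n)

  pow-+ : ∀ x a b → pow x (a ℕ.+ b) ≈ pow x a * pow x b
  pow-+ x a b = begin
    pow x (a ℕ.+ b)     ≡⟨ pow≡^ x (a ℕ.+ b) ⟩
    x ^ (a ℕ.+ b)       ≈⟨ ^-homo-* x a b ⟩
    x ^ a * x ^ b       ≡⟨ ≡.cong₂ _*_ (pow≡^ x a) (pow≡^ x b) ⟨
    pow x a * pow x b   ∎

  pow-* : ∀ x y a → pow (x * y) a ≈ pow x a * pow y a
  pow-* x y a = begin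
    pow (x * y) a       ≡⟨ pow≡^ (x * y) a ⟩
    (x * y) ^ a         ≈⟨ ^-distrib-* x y a ⟩
    x ^ a * y ^ a       ≡⟨ ≡.cong₂ _*_ (pow≡^ x a) (pow≡^ y a) ⟨
    pow x a * pow y a   ∎

  ⊙-applyUpTo : ∀ F G n → (F ⊙ G) n ≡ sumR (applyUpTo (λ k → F k * G (n ∸ k)) (suc n))
  ⊙-applyUpTo F G n = ≡.cong sumR (List.map-applyUpTo (λ i → i) (λ k → F k * G (n ∸ k)) (suc n))

  sumR-applyUpTo-cong : ∀ n {f g : ℕ → Carrier} → (∀ i → f i ≈ g i) →
    sumR (applyUpTo f n) ≈ sumR (applyUpTo g n)
  sumR-applyUpTo-cong zero    _   = refl
  sumR-applyUpTo-cong (suc n) f≈g = +-cong (f≈g 0) (sumR-applyUpTo-cong n (λ i → f≈g (suc i)))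

  sumR-applyUpTo-zero : ∀ n {f : ℕ → Carrier} → (∀ i → f i ≈ 0#) → sumR (applyUpTo f n) ≈ 0#
  sumR-applyUpTo-zero zero    _   = refl
  sumR-applyUpTo-zero (suc n) f≈0 =
    trans (+-cong (f≈0 0) (sumR-applyUpTo-zero n (λ i → f≈0 (suc i)))) (+-identityˡ 0#)

  zS⊙-zero : ∀ F → (zS ⊙ F) 0 ≈ 0#
  zS⊙-zero F = trans (+-identityʳ _) (zeroˡ (F 0))

  zS⊙-suc : ∀ F n → (zS ⊙ F) (suc n) ≈ F n
  zS⊙-suc F n = begin
    (zS ⊙ F) (suc n)
      ≡⟨ ⊙-applyUpTo zS F (suc n) ⟩
    0# * F (suc n) + (1# * F n + sumR (applyUpTo (λ i → 0# * F (n ∸ suc i)) n))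
      ≈⟨ +-cong (zeroˡ _) (+-cong (*-identityˡ _) (sumR-applyUpTo-zero n (λ i → zeroˡ _))) ⟩
    0# + (F n + 0#)
      ≈⟨ trans (+-identityˡ _) (+-identityʳ _) ⟩
    F n ∎

  zS⊙⊙-zero : ∀ F G → ((zS ⊙ F) ⊙ G) 0 ≈ 0#
  zS⊙⊙-zero F G = trans (+-identityʳ _) (trans (*-congʳ (zS⊙-zero F)) (zeroˡ (G 0)))

  zS⊙⊙-suc : ∀ F G n → ((zS ⊙ F) ⊙ G) (suc n) ≈ (F ⊙ G) n
  zS⊙⊙-suc F G n = begin
    ((zS ⊙ F) ⊙ G) (suc n)
      ≡⟨ ⊙-applyUpTo (zS ⊙ F) G (suc n) ⟩
    (zS ⊙ F) 0 * G (suc n) + sumR (applyUpTo (λ k → (zS ⊙ F) (suc k) * G (n ∸ k)) (suc n))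
      ≈⟨ +-cong (trans (*-congʳ (zS⊙-zero F)) (zeroˡ _))
                (sumR-applyUpTo-cong (suc n) (λ k → *-congʳ {G (n ∸ k)} (zS⊙-suc F k))) ⟩
    0# + sumR (applyUpTo (λ k → F k * G (n ∸ k)) (suc n))
      ≈⟨ +-identityˡ _ ⟩
    sumR (applyUpTo (λ k → F k * G (n ∸ k)) (suc n))
      ≡⟨ ⊙-applyUpTo F G n ⟨
    (F ⊙ G) n ∎

  weight : Carrier → Carrier → List ℕ → Carrier
  weight q t xs = pow q (occ123 xs) * pow t (occ12 xs)

  P≡sum-weight : ∀ q t n → P q t n ≡ sumR (map (weight q t) (avoiderLists n))
  P≡sum-weight q t n = ≡.cong sumR (≡.trans
    (List.map-cong (λ π → ≡.cong₂ (λ a b → pow q a * pow t b) (count123≡occ123 π) (count12≡occ12 π))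
                   (avoiders132 n))
    (List.map-∘ (avoiders132 n)))

  weight-glue : ∀ q t {k m α β} → Avoider k α → Avoider m β →
    weight q t (glue k m α β) ≈ (pow t k * weight q (q * t) α) * weight q t β
  weight-glue q t {k} {m} {α} {β} (isPermutation _ α<k ≡.refl , _) (isPermutation _ β<m _ , _) = begin
    pow q (occ123 (glue k m α β)) * pow t (occ12 (glue k m α β))
      ≡⟨ ≡.cong₂ (λ a b → pow q a * pow t b) (occ123-glue α<k β<m) (occ12-glue α<k β<m) ⟩
    pow q (a₁₂₃ ℕ.+ a₁₂ ℕ.+ b₁₂₃) * pow t (a₁₂ ℕ.+ k ℕ.+ b₁₂)
      ≈⟨ *-cong (trans (pow-+ q (a₁₂₃ ℕ.+ a₁₂) b₁₂₃) (*-congʳ (pow-+ q a₁₂₃ a₁₂)))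
                (trans (pow-+ t (a₁₂ ℕ.+ k) b₁₂) (*-congʳ (pow-+ t a₁₂ k))) ⟩
    ((pow q a₁₂₃ * pow q a₁₂) * pow q b₁₂₃) * ((pow t a₁₂ * pow t k) * pow t b₁₂)
      ≈⟨ *-Solver.solve 6
           (λ x₁ x₂ x₃ y₁ y₂ y₃ → ((x₁ ⊛ x₂) ⊛ x₃) ⊛ ((y₁ ⊛ y₂) ⊛ y₃) ⊜ (y₂ ⊛ (x₁ ⊛ (x₂ ⊛ y₁))) ⊛ (x₃ ⊛ y₃))
           refl (pow q a₁₂₃) (pow q a₁₂) (pow q b₁₂₃) (pow t a₁₂) (pow t k) (pow t b₁₂) ⟩
    (pow t k * (pow q a₁₂₃ * (pow q a₁₂ * pow t a₁₂))) * (pow q b₁₂₃ * pow t b₁₂)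
      ≈⟨ *-congʳ (*-congˡ (*-congˡ (sym (pow-* q t a₁₂)))) ⟩
    (pow t k * weight q (q * t) α) * weight q t β ∎
    where
    open *-Solver using (_⊜_) renaming (_⊕_ to _⊛_)
    a₁₂₃ a₁₂ b₁₂₃ b₁₂ : ℕ
    a₁₂₃ = occ123 α
    a₁₂  = occ12 α
    b₁₂₃ = occ123 β
    b₁₂  = occ12 β

  sum-weight-gluings : ∀ q t k m →
    sumR (map (weight q t) (gluings k m)) ≈ (pow t k * P q (q * t) k) * P q t m
  sum-weight-gluings q t k m = begin
    sumR (map w (concatMap (λ α → map (glue k m α) (avoiderLists m)) (avoiderLists k)))
      ≈⟨ sumR-concatMap w _ (avoiderLists k) ⟩
    sumR (map (λ α → sumR (map w (map (glue k m α) (avoiderLists m)))) (avoiderLists k))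
      ≈⟨ sumR-cong row ⟩
    sumR (map (λ α → (pow t k * weight q (q * t) α) * sumR (map w (avoiderLists m))) (avoiderLists k))
      ≈⟨ *-distribʳ-sumR _ (λ α → pow t k * weight q (q * t) α) (avoiderLists k) ⟨
    sumR (map (λ α → pow t k * weight q (q * t) α) (avoiderLists k)) * sumR (map w (avoiderLists m))
      ≈⟨ *-congʳ (*-distribˡ-sumR (pow t k) (weight q (q * t)) (avoiderLists k)) ⟨
    (pow t k * sumR (map (weight q (q * t)) (avoiderLists k))) * sumR (map w (avoiderLists m))
      ≡⟨ ≡.cong₂ (λ a b → (pow t k * a) * b) (P≡sum-weight q (q * t) k) (P≡sum-weight q t m) ⟨
    (pow t k * P q (q * t) k) * P q t m ∎
    where
    w : List ℕ → Carrier
    w = weight q t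
    row : ∀ {α} → α ∈ avoiderLists k →
      sumR (map w (map (glue k m α) (avoiderLists m)))
        ≈ (pow t k * weight q (q * t) α) * sumR (map w (avoiderLists m))
    row {α} α∈ = begin
      sumR (map w (map (glue k m α) (avoiderLists m)))
        ≡⟨ ≡.cong sumR (List.map-∘ (avoiderLists m)) ⟨
      sumR (map (λ β → w (glue k m α β)) (avoiderLists m))
        ≈⟨ sumR-cong (λ β∈ → weight-glue q t (∈avoiderLists⁻ {k} α∈) (∈avoiderLists⁻ {m} β∈)) ⟩
      sumR (map (λ β → (pow t k * weight q (q * t) α) * w β) (avoiderLists m))
        ≈⟨ *-distribˡ-sumR (pow t k * weight q (q * t) α) w (avoiderLists m) ⟨
      (pow t k * weight q (q * t) α) * sumR (map w (avoiderLists m)) ∎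

  P-zero : ∀ q t → P q t 0 ≈ 1#
  P-zero q t = trans (+-identityʳ _) (*-identityˡ 1#)

  P-suc : ∀ q t n → P q t (suc n) ≈ (substZ t (P q (q * t)) ⊙ P q t) n
  P-suc q t n = begin
    P q t (suc n)
      ≡⟨ P≡sum-weight q t (suc n) ⟩
    sumR (map (weight q t) (avoiderLists (suc n)))
      ≈⟨ sumR-reindex (weight q t) (avoiderLists-unique (suc n)) (allGluings-unique n)
           (mk⇔ (λ xs∈ → ∈allGluings⁺ (∈avoiderLists⁻ {suc n} xs∈))
                (λ xs∈ → ∈avoiderLists⁺ (∈allGluings⁻ {n} xs∈))) ⟩
    sumR (map (weight q t) (allGluings n))
      ≈⟨ sumR-concatMap (weight q t) (λ k → gluings k (n ∸ k)) (upTo (suc n)) ⟩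
    sumR (map (λ k → sumR (map (weight q t) (gluings k (n ∸ k)))) (upTo (suc n)))
      ≈⟨ sumR-cong {xs = upTo (suc n)} (λ {k} _ → sum-weight-gluings q t k (n ∸ k)) ⟩
    (substZ t (P q (q * t)) ⊙ P q t) n ∎

mainTheorem1 : ∀ {c ℓ} (R : CommutativeSemiring c ℓ) (q t : CommutativeSemiring.Carrier R) (n : ℕ) →
    CommutativeSemiring._≈_ R
      (Series.P R q t n)
      (Series._⊕_ R (Series.oneS R)
        (Series._⊙_ R (Series._⊙_ R (Series.zS R)
          (Series.substZ R t (Series.P R q (CommutativeSemiring._*_ R q t))))
          (Series.P R q t)) n)
mainTheorem1 R q t = recurrence
  where
  open CommutativeSemiring R
  open Series R
  open WeightedSums R
  open import Relation.Binary.Reasoning.Setoid setoid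

  P[zt,qt] : FPS
  P[zt,qt] = substZ t (P q (q * t))

  recurrence : ∀ n → P q t n ≈ (oneS ⊕ ((zS ⊙ P[zt,qt]) ⊙ P q t)) n
  recurrence zero = begin
    P q t 0                                ≈⟨ P-zero q t ⟩
    1#                                     ≈⟨ +-identityʳ 1# ⟨
    1# + 0#                                ≈⟨ +-congˡ (zS⊙⊙-zero P[zt,qt] (P q t)) ⟨
    (oneS ⊕ ((zS ⊙ P[zt,qt]) ⊙ P q t)) 0   ∎
  recurrence (suc n) = begin
    P q t (suc n)                                ≈⟨ P-suc q t n ⟩
    (P[zt,qt] ⊙ P q t) n                         ≈⟨ zS⊙⊙-suc P[zt,qt] (P q t) n ⟨
    ((zS ⊙ P[zt,qt]) ⊙ P q t) (suc n)            ≈⟨ +-identityˡ _ ⟨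
    (oneS ⊕ ((zS ⊙ P[zt,qt]) ⊙ P q t)) (suc n)   ∎
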